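{- Let $\mathbf A$ be a semi-Heyting algebra satisfying (i) $(x^*\to x)^*\approx1$ and (ii) $x\to(y\to z)\approx y\to(x\to z)$. Then $\mathbf A$ satisfies (BT1) $(x\to y)\to(x\to y^*)^*\approx1$. Thus $\mathbb{AT}1\cap\mathbb{EX}\subseteq\mathbb{BT}1$.
   Context: A semi-Heyting algebra is an algebra $\langle A;\wedge,\vee,\to,0,1\rangle$ such that $\langle A;\wedge,\vee,0,1\rangle$ is a bounded lattice and the identities $x\wedge(x\to y)\approx x\wedge y$, $x\wedge(y\to z)\approx x\wedge((x\wedge y)\to(x\wedge z))$, $x\to x\approx1$ hold. Write $x^*:=x\to0$. $\mathbb{AT}1$, $\mathbb{EX}$, $\mathbb{BT}1$ are the varieties of semi-Heyting algebras satisfying, respectively, $(x^*\to x)^*\approx1$, $x\to(y\to z)\approx y\to(x\to z)$, and $(x\to y)\to(x\to y^*)^*\approx1$. -}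

module Defs where

open import Level using (Level; suc; _⊔_)
open import Relation.Binary.Core using (Rel)
open import Algebra.Core using (Op₂)
open import Algebra.Definitions using (Congruent₂)
open import Algebra.Lattice.Structures using (IsLattice)

record SemiHeytingAlgebra (c ℓ : Level) : Set (suc (c ⊔ ℓ)) where
  infixr 5 _⇒_
  infixr 6 _∨_
  infixr 7 _∧_
  infix  4 _≈_
  field
    Carrier   : Set c
    _≈_       : Rel Carrier ℓ
    _∧_       : Op₂ Carrier
    _∨_       : Op₂ Carrier
    _⇒_       : Op₂ Carrier
    𝟘         : Carrier
    𝟙         : Carrier
    isLattice : IsLattice _≈_ _∨_ _∧_
    ⇒-cong    : Congruent₂ _≈_ _⇒_
    𝟘-least   : ∀ x → 𝟘 ∧ x ≈ 𝟘
    𝟙-greatest : ∀ x → x ∧ 𝟙 ≈ x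
    SH1       : ∀ x y → x ∧ (x ⇒ y) ≈ x ∧ y
    SH2       : ∀ x y z → x ∧ (y ⇒ z) ≈ x ∧ ((x ∧ y) ⇒ (x ∧ z))
    SH3       : ∀ x → x ⇒ x ≈ 𝟙

  _* : Carrier → Carrier
  x * = x ⇒ 𝟘
  infix 8 _*

  open IsLattice isLattice public

module _ {c ℓ} (A : SemiHeytingAlgebra c ℓ) where
  open SemiHeytingAlgebra A

  SatisfiesAT1 : Set (c ⊔ ℓ)
  SatisfiesAT1 = ∀ x → ((x *) ⇒ x) * ≈ 𝟙

  SatisfiesEX : Set (c ⊔ ℓ)
  SatisfiesEX = ∀ x y z → x ⇒ (y ⇒ z) ≈ y ⇒ (x ⇒ z)

  SatisfiesBT1 : Set (c ⊔ ℓ)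
  SatisfiesBT1 = ∀ x y → (x ⇒ y) ⇒ (x ⇒ (y *)) * ≈ 𝟙

{-# OPTIONS --safe #-}
module Submission where

-- Every semi-Heyting algebra is pseudocomplemented by x ↦ x*, so for d = x ⇒ y and
-- c = x ⇒ y* the equation c* ≈ d** follows once c ∧ d ≈ 𝟘 and c* ∧ d* ≈ 𝟘; then
-- d ⇒ c* ≈ d ⇒ d** ≈ d* ⇒ d* ≈ 𝟙 by exchange. Both disjointness facts rest on
-- x ⇒ y* ≈ x* ⇒ y**, a consequence of AT1 (which forces x* ⇒ x ≈ 𝟘) and exchange:
-- below x* the element x ⇒ y* coincides with y**.

open import Defs
open import Algebra.Lattice.Bundles using (Lattice)
import Algebra.Lattice.Properties.Lattice as LatticeProperties
open import Relation.Binary.Lattice using (MeetSemilattice)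
import Relation.Binary.Lattice.Properties.MeetSemilattice as MeetSemilatticeProperties
import Relation.Binary.Reasoning.PartialOrder as ≤-Reasoning

module SemiHeytingProperties {c ℓ} (A : SemiHeytingAlgebra c ℓ) where
  open SemiHeytingAlgebra A

  lattice : Lattice c ℓ
  lattice = record { isLattice = isLattice }

  open LatticeProperties lattice public using (∧-idem; poset)

  meetSemilattice : MeetSemilattice c ℓ ℓ
  meetSemilattice = LatticeProperties.∧-orderTheoreticMeetSemilattice lattice

  -- x ≤ y unfolds to x ≈ x ∧ y; several proofs below use it in that form.
  open MeetSemilattice meetSemilattice public
    using (_≤_; x∧y≤x; x∧y≤y; ∧-greatest; antisym)
    renaming (refl to ≤-refl; trans to ≤-trans)
  open MeetSemilatticeProperties meetSemilattice public using (∧-monotonic)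
  open ≤-Reasoning poset

  x∧𝟘≈𝟘 : ∀ x → x ∧ 𝟘 ≈ 𝟘
  x∧𝟘≈𝟘 x = trans (∧-comm x 𝟘) (𝟘-least x)

  x≤𝟘⇒x≈𝟘 : ∀ {x} → x ≤ 𝟘 → x ≈ 𝟘
  x≤𝟘⇒x≈𝟘 {x} x≤𝟘 = trans x≤𝟘 (x∧𝟘≈𝟘 x)

  x∧y≤x⇒y : ∀ x y → x ∧ y ≤ x ⇒ y
  x∧y≤x⇒y x y = begin
    x ∧ y        ≈⟨ SH1 x y ⟨
    x ∧ (x ⇒ y)  ≤⟨ x∧y≤y x (x ⇒ y) ⟩
    x ⇒ y        ∎

  x≤y⇒z⇒x∧y≤z : ∀ {x y z} → x ≤ y ⇒ z → x ∧ y ≤ z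
  x≤y⇒z⇒x∧y≤z {x} {y} {z} x≤y⇒z = begin
    x ∧ y        ≤⟨ ∧-monotonic x≤y⇒z ≤-refl ⟩
    (y ⇒ z) ∧ y  ≈⟨ ∧-comm (y ⇒ z) y ⟩
    y ∧ (y ⇒ z)  ≈⟨ SH1 y z ⟩
    y ∧ z        ≤⟨ x∧y≤y y z ⟩
    z            ∎

  ⇒-cong-below : ∀ {a x x′ y y′} → a ∧ x ≈ a ∧ x′ → a ∧ y ≈ a ∧ y′ →
                 a ∧ (x ⇒ y) ≈ a ∧ (x′ ⇒ y′)
  ⇒-cong-below {a} {x} {x′} {y} {y′} x≈x′ y≈y′ = begin-equality
    a ∧ (x ⇒ y)                ≈⟨ SH2 a x y ⟩
    a ∧ ((a ∧ x) ⇒ (a ∧ y))    ≈⟨ ∧-congˡ (⇒-cong x≈x′ y≈y′) ⟩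
    a ∧ ((a ∧ x′) ⇒ (a ∧ y′))  ≈⟨ SH2 a x′ y′ ⟨
    a ∧ (x′ ⇒ y′)              ∎

  x∧x*≈𝟘 : ∀ x → x ∧ x * ≈ 𝟘
  x∧x*≈𝟘 x = trans (SH1 x 𝟘) (x∧𝟘≈𝟘 x)

  x≤y⇒x≤y*⇒x≈𝟘 : ∀ {x y} → x ≤ y → x ≤ y * → x ≈ 𝟘
  x≤y⇒x≤y*⇒x≈𝟘 {x} {y} x≤y x≤y* = x≤𝟘⇒x≈𝟘 (begin
    x        ≤⟨ ∧-greatest x≤y x≤y* ⟩
    y ∧ y *  ≈⟨ x∧x*≈𝟘 y ⟩
    𝟘        ∎)

  x∧y≈𝟘⇒x≤y* : ∀ {x y} → x ∧ y ≈ 𝟘 → x ≤ y *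
  x∧y≈𝟘⇒x≤y* {x} {y} x∧y≈𝟘 = begin-equality
    x            ≈⟨ 𝟙-greatest x ⟨
    x ∧ 𝟙        ≈⟨ ∧-congˡ (SH3 𝟘) ⟨
    x ∧ (𝟘 ⇒ 𝟘)  ≈⟨ ⇒-cong-below (trans x∧y≈𝟘 (sym (x∧𝟘≈𝟘 x))) refl ⟨
    x ∧ y *      ∎

  x≤y*⇒x∧y≈𝟘 : ∀ {x y} → x ≤ y * → x ∧ y ≈ 𝟘
  x≤y*⇒x∧y≈𝟘 {x} {y} x≤y* =
    x≤y⇒x≤y*⇒x≈𝟘 (x∧y≤y x y) (≤-trans (x∧y≤x x y) x≤y*)

  x≤[y⇒z]*⇒x∧y≤z* : ∀ {x y z} → x ≤ (y ⇒ z) * → x ∧ y ≤ z *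
  x≤[y⇒z]*⇒x∧y≤z* {x} {y} {z} x≤[y⇒z]* = x∧y≈𝟘⇒x≤y* (x≤y⇒x≤y*⇒x≈𝟘
    (≤-trans (∧-monotonic (x∧y≤y x y) ≤-refl) (x∧y≤x⇒y y z))
    (≤-trans (≤-trans (x∧y≤x (x ∧ y) z) (x∧y≤x x y)) x≤[y⇒z]*))

  x≤x** : ∀ x → x ≤ x * *
  x≤x** x = x∧y≈𝟘⇒x≤y* (x∧x*≈𝟘 x)

  x*≈𝟙⇒x≈𝟘 : ∀ {x} → x * ≈ 𝟙 → x ≈ 𝟘
  x*≈𝟙⇒x≈𝟘 {x} x*≈𝟙 =
    x≤y⇒x≤y*⇒x≈𝟘 ≤-refl (trans (sym (𝟙-greatest x)) (∧-congˡ (sym x*≈𝟙)))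

  𝟙*≈𝟘 : 𝟙 * ≈ 𝟘
  𝟙*≈𝟘 = trans (sym (trans (∧-comm 𝟙 (𝟙 *)) (𝟙-greatest (𝟙 *)))) (x∧x*≈𝟘 𝟙)

  x*∧y*≤x⇒y : ∀ x y → x * ∧ y * ≤ x ⇒ y
  x*∧y*≤x⇒y x y = begin-equality
    s            ≈⟨ 𝟙-greatest s ⟨
    s ∧ 𝟙        ≈⟨ ∧-congˡ (SH3 𝟘) ⟨
    s ∧ (𝟘 ⇒ 𝟘)  ≈⟨ ⇒-cong-below (s≤z*⇒s∧z≈s∧𝟘 (x∧y≤x (x *) (y *)))
                                 (s≤z*⇒s∧z≈s∧𝟘 (x∧y≤y (x *) (y *))) ⟨
    s ∧ (x ⇒ y)  ∎
    where
    s = x * ∧ y *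
    s≤z*⇒s∧z≈s∧𝟘 : ∀ {z} → s ≤ z * → s ∧ z ≈ s ∧ 𝟘
    s≤z*⇒s∧z≈s∧𝟘 s≤z* = trans (x≤y*⇒x∧y≈𝟘 s≤z*) (sym (x∧𝟘≈𝟘 s))

  x∧y≈𝟘⇒x*∧y*≈𝟘⇒x*≈y** : ∀ {x y} → x ∧ y ≈ 𝟘 → x * ∧ y * ≈ 𝟘 → x * ≈ y * *
  x∧y≈𝟘⇒x*∧y*≈𝟘⇒x*≈y** {x} {y} x∧y≈𝟘 x*∧y*≈𝟘 =
    antisym (x∧y≈𝟘⇒x≤y* x*∧y*≈𝟘) (x∧y≈𝟘⇒x≤y* y**∧x≈𝟘)
    where
    y**∧x≈𝟘 : y * * ∧ x ≈ 𝟘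
    y**∧x≈𝟘 = x≤y⇒x≤y*⇒x≈𝟘
      (≤-trans (x∧y≤y (y * *) x) (x∧y≈𝟘⇒x≤y* x∧y≈𝟘))
      (x∧y≤x (y * *) x)

module AT1∩EXProperties {c ℓ} (A : SemiHeytingAlgebra c ℓ)
  (at1 : SatisfiesAT1 A) (ex : SatisfiesEX A) where
  open SemiHeytingAlgebra A
  open SemiHeytingProperties A
  open ≤-Reasoning poset

  x*⇒x≈𝟘 : ∀ x → x * ⇒ x ≈ 𝟘
  x*⇒x≈𝟘 x = x*≈𝟙⇒x≈𝟘 (at1 x)

  𝟘⇒𝟙≈𝟘 : 𝟘 ⇒ 𝟙 ≈ 𝟘
  𝟘⇒𝟙≈𝟘 = trans (⇒-cong (sym 𝟙*≈𝟘) refl) (x*⇒x≈𝟘 𝟙)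

  x⇒y*≈y⇒x* : ∀ x y → x ⇒ y * ≈ y ⇒ x *
  x⇒y*≈y⇒x* x y = ex x y 𝟘

  a∧x≈𝟘⇒a≤y⇒a∧[x⇒y]≈𝟘 : ∀ {a x y} → a ∧ x ≈ 𝟘 → a ≤ y → a ∧ (x ⇒ y) ≈ 𝟘
  a∧x≈𝟘⇒a≤y⇒a∧[x⇒y]≈𝟘 {a} {x} {y} a∧x≈𝟘 a≤y = begin-equality
    a ∧ (x ⇒ y)  ≈⟨ ⇒-cong-below (trans a∧x≈𝟘 (sym (x∧𝟘≈𝟘 a)))
                                  (trans (sym a≤y) (sym (𝟙-greatest a))) ⟩
    a ∧ (𝟘 ⇒ 𝟙)  ≈⟨ ∧-congˡ 𝟘⇒𝟙≈𝟘 ⟩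
    a ∧ 𝟘        ≈⟨ x∧𝟘≈𝟘 a ⟩
    𝟘            ∎

  𝟘⇒x≤x* : ∀ x → 𝟘 ⇒ x ≤ x *
  𝟘⇒x≤x* x = x∧y≈𝟘⇒x≤y*
    (trans (∧-comm (𝟘 ⇒ x) x) (a∧x≈𝟘⇒a≤y⇒a∧[x⇒y]≈𝟘 (x∧𝟘≈𝟘 x) ≤-refl))

  x⇒𝟙≈x** : ∀ x → x ⇒ 𝟙 ≈ x * *
  x⇒𝟙≈x** x = antisym x⇒𝟙≤x** x**≤x⇒𝟙
    where
    x⇒𝟙≤x** : x ⇒ 𝟙 ≤ x * *
    x⇒𝟙≤x** = begin
      x ⇒ 𝟙        ≈⟨ ⇒-cong refl (SH3 𝟘) ⟨
      x ⇒ (𝟘 ⇒ 𝟘)  ≈⟨ ex x 𝟘 𝟘 ⟩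
      𝟘 ⇒ x *      ≤⟨ 𝟘⇒x≤x* (x *) ⟩
      x * *        ∎
    x**≤x⇒𝟙 : x * * ≤ x ⇒ 𝟙
    x**≤x⇒𝟙 = begin-equality
      x * *                ≈⟨ 𝟙-greatest (x * *) ⟨
      x * * ∧ 𝟙            ≈⟨ ∧-congˡ (SH3 (x *)) ⟨
      x * * ∧ (x * ⇒ x *)  ≈⟨ ∧-congˡ (x⇒y*≈y⇒x* x (x *)) ⟨
      x * * ∧ (x ⇒ x * *)  ≈⟨ ⇒-cong-below refl (trans (∧-idem (x * *)) (sym (𝟙-greatest (x * *)))) ⟩
      x * * ∧ (x ⇒ 𝟙)      ∎

  x⇒y*≈x*⇒y** : ∀ x y → x ⇒ y * ≈ x * ⇒ y * *
  x⇒y*≈x*⇒y** x y = begin-equality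
    x ⇒ y *                ≈⟨ x⇒y*≈y⇒x* x y ⟩
    y ⇒ x *                ≈⟨ ⇒-cong refl y*⇒[x⇒y]≈x* ⟨
    y ⇒ (y * ⇒ (x ⇒ y))    ≈⟨ ex y (y *) (x ⇒ y) ⟩
    y * ⇒ (y ⇒ (x ⇒ y))    ≈⟨ ⇒-cong refl (ex y x y) ⟩
    y * ⇒ (x ⇒ (y ⇒ y))    ≈⟨ ⇒-cong refl (⇒-cong refl (SH3 y)) ⟩
    y * ⇒ (x ⇒ 𝟙)          ≈⟨ ⇒-cong refl (x⇒𝟙≈x** x) ⟩
    y * ⇒ x * *            ≈⟨ x⇒y*≈y⇒x* (y *) (x *) ⟩
    x * ⇒ y * *            ∎
    where
    y*⇒[x⇒y]≈x* : y * ⇒ (x ⇒ y) ≈ x *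
    y*⇒[x⇒y]≈x* = trans (sym (ex x (y *) y)) (⇒-cong refl (x*⇒x≈𝟘 y))

  x*∧[x⇒y*]≈x*∧y** : ∀ x y → x * ∧ (x ⇒ y *) ≈ x * ∧ y * *
  x*∧[x⇒y*]≈x*∧y** x y = trans (∧-congˡ (x⇒y*≈x*⇒y** x y)) (SH1 (x *) (y * *))

  [x⇒y*]∧[x⇒y]≈𝟘 : ∀ x y → (x ⇒ y *) ∧ (x ⇒ y) ≈ 𝟘
  [x⇒y*]∧[x⇒y]≈𝟘 x y = x≤y⇒x≤y*⇒x≈𝟘 e≤y* e≤y**
    where
    e = (x ⇒ y *) ∧ (x ⇒ y)
    e≤x* : e ≤ x *
    e≤x* = x∧y≈𝟘⇒x≤y* (x≤y⇒x≤y*⇒x≈𝟘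
      (x≤y⇒z⇒x∧y≤z (x∧y≤y (x ⇒ y *) (x ⇒ y)))
      (x≤y⇒z⇒x∧y≤z (x∧y≤x (x ⇒ y *) (x ⇒ y))))
    e≤y** : e ≤ y * *
    e≤y** = begin
      e                    ≤⟨ ∧-greatest e≤x* (x∧y≤x (x ⇒ y *) (x ⇒ y)) ⟩
      x * ∧ (x ⇒ y *)      ≈⟨ x*∧[x⇒y*]≈x*∧y** x y ⟩
      x * ∧ y * *          ≤⟨ x∧y≤y (x *) (y * *) ⟩
      y * *                ∎
    e∧y≈𝟘 : e ∧ y ≈ 𝟘
    e∧y≈𝟘 = begin-equality
      e ∧ y                ≈⟨ ≤-trans (x∧y≤x e y) (x∧y≤y (x ⇒ y *) (x ⇒ y)) ⟩
      (e ∧ y) ∧ (x ⇒ y)    ≈⟨ a∧x≈𝟘⇒a≤y⇒a∧[x⇒y]≈𝟘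
                                (x≤y*⇒x∧y≈𝟘 (≤-trans (x∧y≤x e y) e≤x*)) (x∧y≤y e y) ⟩
      𝟘                    ∎
    e≤y* : e ≤ y *
    e≤y* = x∧y≈𝟘⇒x≤y* e∧y≈𝟘

  [x⇒y*]*∧[x⇒y]*≈𝟘 : ∀ x y → (x ⇒ y *) * ∧ (x ⇒ y) * ≈ 𝟘
  [x⇒y*]*∧[x⇒y]*≈𝟘 x y = x≤y⇒x≤y*⇒x≈𝟘 e≤x⇒y (x∧y≤y ((x ⇒ y *) *) ((x ⇒ y) *))
    where
    e = (x ⇒ y *) * ∧ (x ⇒ y) *
    e≤x* : e ≤ x *
    e≤x* = x∧y≈𝟘⇒x≤y* (x≤y⇒x≤y*⇒x≈𝟘
      (x≤[y⇒z]*⇒x∧y≤z* (x∧y≤y ((x ⇒ y *) *) ((x ⇒ y) *)))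
      (x≤[y⇒z]*⇒x∧y≤z* (x∧y≤x ((x ⇒ y *) *) ((x ⇒ y) *))))
    e∧y**≈𝟘 : e ∧ y * * ≈ 𝟘
    e∧y**≈𝟘 = x≤y⇒x≤y*⇒x≈𝟘 {y = x ⇒ y *}
      (begin
        e ∧ y * *          ≤⟨ ∧-monotonic e≤x* ≤-refl ⟩
        x * ∧ y * *        ≈⟨ x*∧[x⇒y*]≈x*∧y** x y ⟨
        x * ∧ (x ⇒ y *)    ≤⟨ x∧y≤y (x *) (x ⇒ y *) ⟩
        x ⇒ y *            ∎)
      (≤-trans (x∧y≤x e (y * *)) (x∧y≤x ((x ⇒ y *) *) ((x ⇒ y) *)))
    e≤y* : e ≤ y *
    e≤y* = x∧y≈𝟘⇒x≤y* (x≤𝟘⇒x≈𝟘 (begin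
      e ∧ y              ≤⟨ ∧-monotonic ≤-refl (x≤x** y) ⟩
      e ∧ y * *          ≈⟨ e∧y**≈𝟘 ⟩
      𝟘                  ∎))
    e≤x⇒y : e ≤ x ⇒ y
    e≤x⇒y = ≤-trans (∧-greatest e≤x* e≤y*) (x*∧y*≤x⇒y x y)

  bt1 : SatisfiesBT1 A
  bt1 x y = begin-equality
    (x ⇒ y) ⇒ (x ⇒ y *) *    ≈⟨ ⇒-cong refl (x∧y≈𝟘⇒x*∧y*≈𝟘⇒x*≈y**
                                  ([x⇒y*]∧[x⇒y]≈𝟘 x y) ([x⇒y*]*∧[x⇒y]*≈𝟘 x y)) ⟩
    (x ⇒ y) ⇒ (x ⇒ y) * *    ≈⟨ x⇒y*≈y⇒x* (x ⇒ y) ((x ⇒ y) *) ⟩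
    (x ⇒ y) * ⇒ (x ⇒ y) *    ≈⟨ SH3 ((x ⇒ y) *) ⟩
    𝟙                        ∎

theorem10p1 : ∀ {c ℓ} (A : SemiHeytingAlgebra c ℓ) →
    SatisfiesAT1 A → SatisfiesEX A → SatisfiesBT1 A
theorem10p1 A at1 ex = AT1∩EXProperties.bt1 A at1 ex
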